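{- Let $\mathbf A\in\mathsf{BCRL}$ be rigid. Then $\mathbf A$ has at most one proper nontrivial congruence; that is, the congruence lattice of $\mathbf A$ is either the two-element or the three-element chain.
   Context: $\mathsf{BCRL}$ is the variety of bounded commutative residuated lattices $(A,\vee,\wedge,\cdot,\to,0,1)$: $(A,\vee,\wedge)$ a lattice, $(A,\cdot,1)$ a commutative monoid, $ab\le c$ iff $a\le b\to c$, $1$ greatest, $0$ least. An algebra $\mathbf A\in\mathsf{BCRL}$ is rigid if $|A|>2$, $\mathbf A$ is subdirectly irreducible, $\mathbf A$ has no proper subalgebras other than $\{0,1\}$, and $\mathbf A/\theta\cong\mathbf 2$ (two-element Boolean algebra) for every proper nontrivial congruence $\theta$ of $\mathbf A$. -}

module Defs where

open import Level using (0ℓ)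
open import Data.Bool using (Bool; true; false; _∨_; _∧_; not)
open import Data.Empty using (⊥)
open import Data.Product using (Σ; ∃; _×_; _,_)
open import Data.Sum using (_⊎_)
open import Relation.Nullary using (¬_)
open import Relation.Binary.PropositionalEquality using (_≡_)
open import Relation.Binary.Structures using (IsEquivalence)
open import Algebra.Core using (Op₂)
open import Algebra.Structures using (IsCommutativeMonoid)
open import Algebra.Lattice.Structures using (IsLattice)

record BCRL : Set₁ where
  field
    Carrier : Set
    _⊔_ _⊓_ _·_ _⇒_ : Op₂ Carrier
    𝟎 𝟏 : Carrier
    isLattice : IsLattice _≡_ _⊔_ _⊓_
    isCommMonoid : IsCommutativeMonoid _≡_ _·_ 𝟏
  _≤_ : Carrier → Carrier → Set
  x ≤ y = x ⊓ y ≡ x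
  field
    residuation : ∀ a b c → (a · b) ≤ c → a ≤ (b ⇒ c)
    residuation⁻¹ : ∀ a b c → a ≤ (b ⇒ c) → (a · b) ≤ c
    𝟏-top : ∀ a → a ≤ 𝟏
    𝟎-bottom : ∀ a → 𝟎 ≤ a

module _ (A : BCRL) where
  open BCRL A

  Rel : Set₁
  Rel = Carrier → Carrier → Set

  record IsCongruence (θ : Rel) : Set where
    field
      isEquivalence : IsEquivalence θ
      ⊔-cong : ∀ {a b c d} → θ a b → θ c d → θ (a ⊔ c) (b ⊔ d)
      ⊓-cong : ∀ {a b c d} → θ a b → θ c d → θ (a ⊓ c) (b ⊓ d)
      ·-cong : ∀ {a b c d} → θ a b → θ c d → θ (a · c) (b · d)
      ⇒-cong : ∀ {a b c d} → θ a b → θ c d → θ (a ⇒ c) (b ⇒ d)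

  _⊆_ : Rel → Rel → Set
  θ ⊆ ψ = ∀ a b → θ a b → ψ a b

  _≐_ : Rel → Rel → Set
  θ ≐ ψ = (θ ⊆ ψ) × (ψ ⊆ θ)

  Δ : Rel
  Δ a b = a ≡ b

  ∇ : Rel
  ∇ a b = Data.Unit.⊤
    where import Data.Unit

  ProperNontrivial : Rel → Set
  ProperNontrivial θ = IsCongruence θ × ¬ (θ ⊆ Δ) × ¬ (∇ ⊆ θ)

  SubdirectlyIrreducible : Set₁
  SubdirectlyIrreducible =
    Σ Rel λ μ → IsCongruence μ × ¬ (μ ⊆ Δ) ×
      (∀ θ → IsCongruence θ → ¬ (θ ⊆ Δ) → μ ⊆ θ)

  record IsSubuniverse (S : Carrier → Set) : Set where
    field
      𝟎∈ : S 𝟎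
      𝟏∈ : S 𝟏
      ⊔∈ : ∀ {a b} → S a → S b → S (a ⊔ b)
      ⊓∈ : ∀ {a b} → S a → S b → S (a ⊓ b)
      ·∈ : ∀ {a b} → S a → S b → S (a · b)
      ⇒∈ : ∀ {a b} → S a → S b → S (a ⇒ b)

  MoreThanTwo : Set
  MoreThanTwo = Σ Carrier λ a → Σ Carrier λ b → Σ Carrier λ c →
    ¬ (a ≡ b) × ¬ (a ≡ c) × ¬ (b ≡ c)

  OnlyTrivialSubalgebras : Set₁
  OnlyTrivialSubalgebras = ∀ S → IsSubuniverse S →
    (∀ x → (S x → (x ≡ 𝟎 ⊎ x ≡ 𝟏)) × ((x ≡ 𝟎 ⊎ x ≡ 𝟏) → S x))
    ⊎ (∀ x → S x)

  -- A/θ ≅ 2: the quotient algebra (carrier A with equality θ) is isomorphic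
  -- to the two-element Boolean algebra 2 = (Bool, ∨, ∧, ∧, ⇒, false, true),
  -- via a map f : A → Bool that is well defined and injective on A/θ
  -- (θ a b ↔ f a ≡ f b), surjective, and a homomorphism.
  _⇒𝔹_ : Bool → Bool → Bool
  x ⇒𝔹 y = not x ∨ y

  QuotientIsoTwo : Rel → Set
  QuotientIsoTwo θ = Σ (Carrier → Bool) λ f →
    (∀ a b → θ a b → f a ≡ f b) ×
    (∀ a b → f a ≡ f b → θ a b) ×
    (∀ y → ∃ λ a → f a ≡ y) ×
    (∀ a b → f (a ⊔ b) ≡ (f a ∨ f b)) ×
    (∀ a b → f (a ⊓ b) ≡ (f a ∧ f b)) ×
    (∀ a b → f (a · b) ≡ (f a ∧ f b)) ×
    (∀ a b → f (a ⇒ b) ≡ (f a ⇒𝔹 f b)) ×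
    (f 𝟎 ≡ false) × (f 𝟏 ≡ true)

  record Rigid : Set₁ where
    field
      moreThanTwo : MoreThanTwo
      si : SubdirectlyIrreducible
      onlyTrivialSubalgebras : OnlyTrivialSubalgebras
      quotientsTwo : ∀ θ → ProperNontrivial θ → QuotientIsoTwo θ

-- Both quotient maps f, g : A → 2 are homomorphisms, so their equalizer is a
-- subalgebra. If it is all of A then f = g and θ = ker f = ker g = ψ. If it is
-- {0,1}, then for a (θ ∩ ψ) b both f and g send a ⇒ b and b ⇒ a to 1, so these
-- lie in the equalizer and, not being 0, equal 1; hence a = b, i.e. θ ∩ ψ is the
-- identity, which contradicts subdirect irreducibility.
module Submission where

open import Defs
open import Data.Bool using (Bool; true; false; _∨_; _∧_; not)
open import Data.Bool.Properties using (∨-inverseˡ)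
open import Data.Empty using (⊥-elim)
open import Data.Product using (Σ; _×_; _,_; proj₁)
open import Data.Sum using (_⊎_; inj₁; inj₂)
open import Relation.Nullary using (¬_)
open import Relation.Binary.PropositionalEquality
open import Algebra.Structures using (IsCommutativeMonoid)
open import Algebra.Lattice.Structures using (IsLattice)

module _ {A : BCRL} where
  open BCRL A

  ⇒≡𝟏⇒≤ : ∀ {a b} → a ⇒ b ≡ 𝟏 → a ≤ b
  ⇒≡𝟏⇒≤ {a} {b} a⇒b≡𝟏 = subst (_≤ b) (identityˡ a)
    (residuation⁻¹ 𝟏 a b (subst (𝟏 ≤_) (sym a⇒b≡𝟏) (𝟏-top 𝟏)))
    where open IsCommutativeMonoid isCommMonoid using (identityˡ)

  ≤-antisym : ∀ {a b} → a ≤ b → b ≤ a → a ≡ b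
  ≤-antisym {a} {b} a≤b b≤a = begin
    a      ≡⟨ a≤b ⟨
    a ⊓ b  ≡⟨ ∧-comm a b ⟩
    b ⊓ a  ≡⟨ b≤a ⟩
    b      ∎
    where
    open IsLattice isLattice using (∧-comm)
    open ≡-Reasoning

  record IsHomTo𝟚 (f : Carrier → Bool) : Set where
    field
      ⊔-homo : ∀ a b → f (a ⊔ b) ≡ f a ∨ f b
      ⊓-homo : ∀ a b → f (a ⊓ b) ≡ f a ∧ f b
      ·-homo : ∀ a b → f (a · b) ≡ f a ∧ f b
      ⇒-homo : ∀ a b → f (a ⇒ b) ≡ _⇒𝔹_ A (f a) (f b)
      𝟎-homo : f 𝟎 ≡ false
      𝟏-homo : f 𝟏 ≡ true

    ⇒-homo-true : ∀ {a b} → f a ≡ f b → f (a ⇒ b) ≡ true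
    ⇒-homo-true {a} {b} fa≡fb = begin
      f (a ⇒ b)          ≡⟨ ⇒-homo a b ⟩
      not (f a) ∨ f b    ≡⟨ cong (λ x → not x ∨ f b) fa≡fb ⟩
      not (f b) ∨ f b    ≡⟨ ∨-inverseˡ (f b) ⟩
      true               ∎
      where open ≡-Reasoning

  Kernel : (Carrier → Bool) → Rel A
  Kernel f a b = f a ≡ f b

  quotient-kernel : ∀ {θ} → QuotientIsoTwo A θ →
    Σ (Carrier → Bool) λ f → IsHomTo𝟚 f × _≐_ A θ (Kernel f)
  quotient-kernel (f , wd , inj , _ , ⊔h , ⊓h , ·h , ⇒h , 𝟎h , 𝟏h) =
    f , record { ⊔-homo = ⊔h ; ⊓-homo = ⊓h ; ·-homo = ·h ; ⇒-homo = ⇒h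
               ; 𝟎-homo = 𝟎h ; 𝟏-homo = 𝟏h }
      , wd , inj

  Equalizer : (Carrier → Bool) → (Carrier → Bool) → Carrier → Set
  Equalizer f g x = f x ≡ g x

  equalizer-isSubuniverse : ∀ {f g} → IsHomTo𝟚 f → IsHomTo𝟚 g →
    IsSubuniverse A (Equalizer f g)
  equalizer-isSubuniverse {f} {g} hf hg = record
    { 𝟎∈ = trans F.𝟎-homo (sym G.𝟎-homo)
    ; 𝟏∈ = trans F.𝟏-homo (sym G.𝟏-homo)
    ; ⊔∈ = closed _⊔_ _∨_ F.⊔-homo G.⊔-homo
    ; ⊓∈ = closed _⊓_ _∧_ F.⊓-homo G.⊓-homo
    ; ·∈ = closed _·_ _∧_ F.·-homo G.·-homo
    ; ⇒∈ = closed _⇒_ (_⇒𝔹_ A) F.⇒-homo G.⇒-homo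
    }
    where
    module F = IsHomTo𝟚 hf
    module G = IsHomTo𝟚 hg
    closed : (_∘_ : Carrier → Carrier → Carrier) (_•_ : Bool → Bool → Bool) →
      (∀ a b → f (a ∘ b) ≡ f a • f b) → (∀ a b → g (a ∘ b) ≡ g a • g b) →
      ∀ {a b} → f a ≡ g a → f b ≡ g b → f (a ∘ b) ≡ g (a ∘ b)
    closed _∘_ _•_ fh gh {a} {b} p q =
      trans (fh a b) (trans (cong₂ _•_ p q) (sym (gh a b)))

  kernels-meet-trivial : ∀ {f g} → IsHomTo𝟚 f → IsHomTo𝟚 g →
    (∀ x → Equalizer f g x → x ≡ 𝟎 ⊎ x ≡ 𝟏) →
    ∀ {a b} → Kernel f a b → Kernel g a b → a ≡ b
  kernels-meet-trivial {f} {g} hf hg eq⊆𝟎𝟏 fa≡fb ga≡gb =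
    ≤-antisym (kernels⇒≤ fa≡fb ga≡gb) (kernels⇒≤ (sym fa≡fb) (sym ga≡gb))
    where
    module F = IsHomTo𝟚 hf
    module G = IsHomTo𝟚 hg
    kernels⇒≤ : ∀ {a b} → Kernel f a b → Kernel g a b → a ≤ b
    kernels⇒≤ {a} {b} fab gab
      with eq⊆𝟎𝟏 (a ⇒ b) (trans (F.⇒-homo-true fab) (sym (G.⇒-homo-true gab)))
    ... | inj₂ a⇒b≡𝟏 = ⇒≡𝟏⇒≤ a⇒b≡𝟏
    ... | inj₁ a⇒b≡𝟎 with () ← trans (sym (F.⇒-homo-true fab))
                                  (trans (cong f a⇒b≡𝟎) F.𝟎-homo)

  ≐-via-equal-kernels : ∀ {θ ψ} {f g : Carrier → Bool} → (∀ x → f x ≡ g x) →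
    _≐_ A θ (Kernel f) → _≐_ A ψ (Kernel g) → _≐_ A θ ψ
  ≐-via-equal-kernels {f = f} {g} f≗g (θ⊆ker , ker⊆θ) (ψ⊆ker , ker⊆ψ) =
    (λ a b θab → ker⊆ψ a b (ker-f⊆ker-g (θ⊆ker a b θab)))
    , (λ a b ψab → ker⊆θ a b (ker-g⊆ker-f (ψ⊆ker a b ψab)))
    where
    ker-f⊆ker-g : ∀ {a b} → Kernel f a b → Kernel g a b
    ker-f⊆ker-g {a} {b} fab = trans (sym (f≗g a)) (trans fab (f≗g b))
    ker-g⊆ker-f : ∀ {a b} → Kernel g a b → Kernel f a b
    ker-g⊆ker-f {a} {b} gab = trans (f≗g a) (trans gab (sym (f≗g b)))

  si-meet-nontrivial : SubdirectlyIrreducible A → ∀ {θ ψ} →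
    ProperNontrivial A θ → ProperNontrivial A ψ →
    ¬ (∀ a b → θ a b → ψ a b → a ≡ b)
  si-meet-nontrivial (μ , _ , μ≉Δ , monolith)
                     (θ-cong , θ≉Δ , _) (ψ-cong , ψ≉Δ , _) θ∩ψ⊆Δ =
    μ≉Δ λ a b μab →
      θ∩ψ⊆Δ a b (monolith _ θ-cong θ≉Δ a b μab) (monolith _ ψ-cong ψ≉Δ a b μab)

lemma2p6 : (A : BCRL) → Rigid A →
    ∀ θ ψ → ProperNontrivial A θ → ProperNontrivial A ψ → _≐_ A θ ψ
lemma2p6 A R θ ψ pθ pψ
  with quotient-kernel (Rigid.quotientsTwo R θ pθ)
     | quotient-kernel (Rigid.quotientsTwo R ψ pψ)
... | f , hf , θ≐ker | g , hg , ψ≐ker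
  with Rigid.onlyTrivialSubalgebras R _ (equalizer-isSubuniverse hf hg)
... | inj₂ f≗g = ≐-via-equal-kernels {A} f≗g θ≐ker ψ≐ker
... | inj₁ eq≐𝟎𝟏 = ⊥-elim (si-meet-nontrivial (Rigid.si R) pθ pψ λ a b θab ψab →
  kernels-meet-trivial hf hg (λ x → proj₁ (eq≐𝟎𝟏 x))
    (proj₁ θ≐ker a b θab) (proj₁ ψ≐ker a b ψab))
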